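{- Let $\mathcal{A}$ be the set of positive integers $N$ for which there exists a positive integer $d$ such that $N, N+d, N+2d$ are three consecutive terms of the increasing sequence of powerful numbers (such $d$ is then unique). For $N \in \mathcal{A}$ with corresponding $d$, let $\mathcal{A}_2$ be the set of those $N \in \mathcal{A}$ for which exactly two of $N, N+d, N+2d$ are perfect squares. Then for any $N \in \mathcal{A}$ (with its corresponding $d$), we have $N \in \mathcal{A}_2$ if and only if there exists an integer $x \ge 3$ with $$N = (x-2)^2, \qquad N+d = (x-1)^2, \qquad N+2d = x^2 - 2.$$
   Context: A positive integer $n$ is powerful if for every prime $p \mid n$ also $p^2 \mid n$. "Three consecutive terms of the sequence of powerful numbers" means $N, N+d, N+2d$ are powerful and no powerful number lies strictly between $N$ and $N+d$ or strictly between $N+d$ and $N+2d$. -}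

module Defs where

open import Data.Nat using (ℕ; _+_; _*_; _^_; _<_)
open import Data.Nat.Divisibility using (_∣_)
open import Data.Nat.Primality using (Prime)
open import Data.Product using (Σ; _×_)
open import Data.Sum using (_⊎_)
open import Relation.Nullary using (¬_)
open import Relation.Binary.PropositionalEquality using (_≡_)

-- n is powerful: every prime divisor p of n satisfies p² ∣ n.
-- (0 vacuously fails to be excluded here, but all numbers considered
--  below are positive, since N ≥ 1.)
Powerful : ℕ → Set
Powerful n = ∀ p → Prime p → p ∣ n → p ^ 2 ∣ n

NoPowerfulBetween : ℕ → ℕ → Set
NoPowerfulBetween a b = ∀ m → a < m → m < b → ¬ Powerful m

ConsecutivePowerful3 : ℕ → ℕ → Set
ConsecutivePowerful3 N d =
  Powerful N × Powerful (N + d) × Powerful (N + 2 * d) ×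
  NoPowerfulBetween N (N + d) × NoPowerfulBetween (N + d) (N + 2 * d)

IsSquare : ℕ → Set
IsSquare n = Σ ℕ (λ k → k * k ≡ n)

ExactlyTwoSquares : ℕ → ℕ → ℕ → Set
ExactlyTwoSquares a b c =
  (IsSquare a × IsSquare b × ¬ IsSquare c) ⊎
  (IsSquare a × ¬ IsSquare b × IsSquare c) ⊎
  (¬ IsSquare a × IsSquare b × IsSquare c)

-- Squares are powerful, so two squares that are adjacent in the sequence of
-- powerful numbers are consecutive squares a², (a+1)².  If N and N+d are the
-- squares, then d = 2a+1 and N+2d = (a+2)² − 2, which lies strictly between
-- (a+1)² and (a+2)².  If N+d and N+2d are the squares b², (b+1)², then
-- d = 2b+1 and N = (b−1)² − 2, so the powerful number (b−1)² would fall
-- between N and N+d.  If N = a² and N+2d are the squares, the square (a+1)²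
-- lies in (N, N+2d]; it is not N+d, misses both gaps, and equality with N+2d
-- would make 2d = 2a+1 odd.
module Submission where

open import Defs
open import Data.Nat using (ℕ; zero; suc; _+_; _*_; _∸_; _^_; _≤_; _<_; s≤s; z≤n; z<s)
open import Data.Nat.Properties
open import Data.Nat.Divisibility using (_∣_; *-pres-∣)
open import Data.Nat.Primality using (euclidsLemma)
open import Data.Nat.Tactic.RingSolver using (solve-∀)
open import Data.Product using (Σ; _×_; _,_)
open import Data.Sum using (inj₁; inj₂; reduce)
open import Data.Empty using (⊥; ⊥-elim)
open import Function.Bundles using (_⇔_; mk⇔)
open import Relation.Binary.Definitions using (tri<; tri≈; tri>)
open import Relation.Nullary using (¬_)
open import Relation.Binary.PropositionalEquality using (_≡_; refl; sym; trans; cong; subst)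

SquaresThenSquareMinusTwo : ℕ → ℕ → Set
SquaresThenSquareMinusTwo N d =
  Σ ℕ (λ x → 3 ≤ x × N ≡ (x ∸ 2) ^ 2 × N + d ≡ (x ∸ 1) ^ 2 × N + 2 * d ≡ x ^ 2 ∸ 2)

square≡^2 : ∀ m → m * m ≡ m ^ 2
square≡^2 m = cong (m *_) (sym (*-identityʳ m))

suc-square : ∀ a → suc a * suc a ≡ a * a + suc (2 * a)
suc-square = solve-∀

square-powerful : ∀ k → Powerful (k * k)
square-powerful k p p-prime p∣k*k =
  subst (_∣ k * k) (square≡^2 p) (*-pres-∣ p∣k p∣k)
  where
  p∣k : p ∣ k
  p∣k = reduce (euclidsLemma k k p-prime p∣k*k)

square-cancel-< : ∀ m n → m * m < n * n → m < n
square-cancel-< m n m²<n² = ≰⇒> (λ n≤m → <⇒≱ m²<n² (*-mono-≤ n≤m n≤m))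

square-< : ∀ a → a * a < suc a * suc a
square-< a = *-mono-< (n<1+n a) (n<1+n a)

square-suc-≤ : ∀ a c → a * a < c * c → suc a * suc a ≤ c * c
square-suc-≤ a c a²<c² = *-mono-≤ a<c a<c
  where
  a<c : a < c
  a<c = square-cancel-< a c a²<c²

no-square-between : ∀ a {m} → a * a < m → m < suc a * suc a → ¬ IsSquare m
no-square-between a a²<m m<[1+a]² (k , refl) =
  <⇒≱ (square-cancel-< a k a²<m) (≤-pred (square-cancel-< k (suc a) m<[1+a]²))

adjacent-squares : ∀ {u d} a b → 0 < d → NoPowerfulBetween u (u + d) →
  a * a ≡ u → b * b ≡ u + d → b ≡ suc a × d ≡ suc (2 * a)
adjacent-squares {u} {d} a b 0<d gap refl b²≡u+d = b≡1+a , d≡1+2a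
  where
  b≡1+a : b ≡ suc a
  b≡1+a with m≤n⇒m<n∨m≡n (square-cancel-< a b (subst (a * a <_) (sym b²≡u+d) (m<m+n u 0<d)))
  ... | inj₂ 1+a≡b = sym 1+a≡b
  ... | inj₁ 1+a<b = ⊥-elim (gap (suc a * suc a) (square-< a)
                              (subst (suc a * suc a <_) b²≡u+d (*-mono-< 1+a<b 1+a<b))
                              (square-powerful (suc a)))
  d≡1+2a : d ≡ suc (2 * a)
  d≡1+2a = +-cancelˡ-≡ u d (suc (2 * a))
             (trans (sym b²≡u+d) (trans (cong (λ c → c * c) b≡1+a) (suc-square a)))

first-two-squares : ∀ {N d} a b → 0 < N → 0 < d → NoPowerfulBetween N (N + d) →
  a * a ≡ N → b * b ≡ N + d → SquaresThenSquareMinusTwo N d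
first-two-squares zero _ () _ _ refl _
first-two-squares (suc a) b 0<N 0<d gap refl b²≡N+d
  with adjacent-squares (suc a) b 0<d gap refl b²≡N+d
... | refl , refl =
  3 + a , s≤s (s≤s (s≤s z≤n)) , square≡^2 (suc a) ,
  trans (sym b²≡N+d) (square≡^2 (2 + a)) ,
  sym (trans (cong (_∸ 2) (trans (sym (square≡^2 (3 + a))) (square-shift (suc a)))) (m+n∸n≡m _ 2))
  where
  square-shift : ∀ a → (2 + a) * (2 + a) ≡ a * a + 2 * suc (2 * a) + 2
  square-shift = solve-∀

outer-squares-with-middle-nonsquare : ∀ {N d} a c →
  NoPowerfulBetween N (N + d) → NoPowerfulBetween (N + d) (N + 2 * d) →
  a * a ≡ N → c * c ≡ N + 2 * d → N < N + 2 * d → ¬ IsSquare (N + d) → ⊥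
outer-squares-with-middle-nonsquare {N} {d} a c gap₁ gap₂ refl c²≡N+2d N<N+2d ¬□
  with <-cmp (suc a * suc a) (N + d)
... | tri< [1+a]²<N+d _ _ = gap₁ _ (square-< a) [1+a]²<N+d (square-powerful (suc a))
... | tri≈ _ [1+a]²≡N+d _ = ¬□ (suc a , [1+a]²≡N+d)
... | tri> _ _ N+d<[1+a]²
  with m≤n⇒m<n∨m≡n (subst (suc a * suc a ≤_) c²≡N+2d
                      (square-suc-≤ a c (subst (N <_) (sym c²≡N+2d) N<N+2d)))
...   | inj₁ [1+a]²<N+2d = gap₂ _ N+d<[1+a]² [1+a]²<N+2d (square-powerful (suc a))
...   | inj₂ [1+a]²≡N+2d = even≢odd d a
         (sym (+-cancelˡ-≡ N _ _ (trans (sym (suc-square a)) [1+a]²≡N+2d)))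

last-two-squares : ∀ {N d} b c → 0 < d →
  NoPowerfulBetween N (N + d) → NoPowerfulBetween (N + d) (N + d + d) →
  b * b ≡ N + d → c * c ≡ N + d + d → ⊥
last-two-squares {N} b c 0<d gap₁ gap₂ b²≡N+d c²≡N+2d
  with adjacent-squares b c 0<d gap₂ b²≡N+d c²≡N+2d
last-two-squares {N} zero _ _ _ _ b²≡N+d _ | _ , refl =
  1+n≢0 (trans (sym (+-suc N 0)) (sym b²≡N+d))
last-two-squares {N} (suc b) _ _ gap₁ _ b²≡N+d _ | _ , refl =
  gap₁ (b * b) (subst (N <_) N+2≡b² (m<m+n N z<s))
    (subst (b * b <_) b²≡N+d (square-< b)) (square-powerful b)
  where
  N+2≡b² : N + 2 ≡ b * b
  N+2≡b² = +-cancelʳ-≡ (suc (2 * b)) _ _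
             (trans (regroup N b) (trans (sym b²≡N+d) (suc-square b)))
    where
    regroup : ∀ N b → N + 2 + suc (2 * b) ≡ N + suc (2 * suc b)
    regroup = solve-∀

square-minus-two-not-square : ∀ y → ¬ IsSquare ((3 + y) ^ 2 ∸ 2)
square-minus-two-not-square y =
  subst (λ m → ¬ IsSquare m) (sym x²∸2≡)
    (no-square-between (2 + y) (m<m+n _ z<s) (subst (gap <_) (sym (x²≡ y)) (m<m+n gap z<s)))
  where
  gap : ℕ
  gap = (2 + y) * (2 + y) + (3 + 2 * y)
  x²≡ : ∀ y → (3 + y) * (3 + y) ≡ (2 + y) * (2 + y) + (3 + 2 * y) + 2
  x²≡ = solve-∀
  x²∸2≡ : (3 + y) ^ 2 ∸ 2 ≡ gap
  x²∸2≡ = trans (cong (_∸ 2) (trans (sym (square≡^2 (3 + y))) (x²≡ y))) (m+n∸n≡m gap 2)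

pattern⇒exactly-two-squares : ∀ {N d} → SquaresThenSquareMinusTwo N d →
  ExactlyTwoSquares N (N + d) (N + 2 * d)
pattern⇒exactly-two-squares (suc (suc (suc y)) , s≤s (s≤s (s≤s _)) , N≡ , N+d≡ , N+2d≡) =
  inj₁ ((suc y , trans (square≡^2 (suc y)) (sym N≡)) ,
        (2 + y , trans (square≡^2 (2 + y)) (sym N+d≡)) ,
        subst (λ m → ¬ IsSquare m) (sym N+2d≡) (square-minus-two-not-square y))

mainTheorem4 : (N d : ℕ) → 0 < N → 0 < d → ConsecutivePowerful3 N d →
    ExactlyTwoSquares N (N + d) (N + 2 * d) ⇔
    Σ ℕ (λ x → 3 ≤ x × N ≡ (x ∸ 2) ^ 2 × N + d ≡ (x ∸ 1) ^ 2 × N + 2 * d ≡ x ^ 2 ∸ 2)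
mainTheorem4 N d 0<N 0<d (_ , _ , _ , gap₁ , gap₂) = mk⇔ forward pattern⇒exactly-two-squares
  where
  N+2d≡N+d+d : N + 2 * d ≡ N + d + d
  N+2d≡N+d+d = trans (cong (λ e → N + (d + e)) (+-identityʳ d)) (sym (+-assoc N d d))

  forward : ExactlyTwoSquares N (N + d) (N + 2 * d) → SquaresThenSquareMinusTwo N d
  forward (inj₁ ((a , a²≡N) , (b , b²≡N+d) , _)) = first-two-squares a b 0<N 0<d gap₁ a²≡N b²≡N+d
  forward (inj₂ (inj₁ ((a , a²≡N) , ¬□ , (c , c²≡N+2d)))) =
    ⊥-elim (outer-squares-with-middle-nonsquare a c gap₁ gap₂ a²≡N c²≡N+2d
              (m<m+n N (≤-trans 0<d (m≤m+n d _))) ¬□)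
  forward (inj₂ (inj₂ (_ , (b , b²≡N+d) , (c , c²≡N+2d)))) =
    ⊥-elim (last-two-squares b c 0<d gap₁ (subst (NoPowerfulBetween (N + d)) N+2d≡N+d+d gap₂)
              b²≡N+d (trans c²≡N+2d N+2d≡N+d+d))
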